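{- Let $G$ be a group regarded as a $G$-space under left multiplication. If $A\subseteq G$ is a kaleidoscopical configuration, then $A$ is complemented in $G$, i.e. there is a subset $B\subseteq G$ such that the multiplication map $A\times B\to G$, $(a,b)\mapsto ab$, is a bijection.
   Context: For a group $G$ acting on a set $X$, a subset $A\subseteq X$ is a kaleidoscopical configuration if there exist a set $C$ and a map $\chi:X\to C$ such that for every $g\in G$ the restriction $\chi|_{gA}:gA\to C$ is a bijection. -}

module Defs where

open import Level using (Level; _⊔_; suc)
open import Algebra.Bundles using (Group)
open import Data.Product using (Σ; ∃; _×_; _,_)
open import Relation.Binary.PropositionalEquality using (_≡_)

module _ {c ℓ : Level} (G : Group c ℓ) where
  open Group G

  Subset : (ℓA : Level) → Set (c ⊔ suc ℓA)
  Subset ℓA = Carrier → Set ℓA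

  _∈_·_ : ∀ {ℓA} → Carrier → Carrier → Subset ℓA → Set (c ⊔ ℓ ⊔ ℓA)
  x ∈ g · A = Σ Carrier λ a → A a × (x ≈ g ∙ a)

  IsKaleidoscopical : ∀ {ℓA} (κ : Level) → Subset ℓA → Set (c ⊔ ℓ ⊔ ℓA ⊔ suc κ)
  IsKaleidoscopical κ A =
    Σ (Set κ) λ C → Σ (Carrier → C) λ χ →
      (∀ {x y} → x ≈ y → χ x ≡ χ y) ×
      (∀ g →
        (∀ {x y} → x ∈ g · A → y ∈ g · A → χ x ≡ χ y → x ≈ y) ×
        (∀ (k : C) → Σ Carrier λ x → x ∈ g · A × (χ x ≡ k)))

  MulBijective : ∀ {ℓA ℓB} → Subset ℓA → Subset ℓB → Set (c ⊔ ℓ ⊔ ℓA ⊔ ℓB)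
  MulBijective A B =
    (∀ {a a′ b b′} → A a → B b → A a′ → B b′ →
       a ∙ b ≈ a′ ∙ b′ → (a ≈ a′) × (b ≈ b′)) ×
    (∀ x → Σ Carrier λ a → Σ Carrier λ b → A a × B b × (x ≈ a ∙ b))

  IsComplemented : ∀ {ℓA} (ℓB : Level) → Subset ℓA → Set (c ⊔ ℓ ⊔ ℓA ⊔ suc ℓB)
  IsComplemented ℓB A = Σ (Subset ℓB) λ B → MulBijective A B

-- Fix a colour k and let B be the set of b whose inverse has colour k. For every x, the translate
-- x⁻¹A contains exactly one point of colour k, and a point x⁻¹a of x⁻¹A has colour k exactly when
-- a⁻¹x ∈ B, so x = a (a⁻¹x) is the unique factorisation of x through A × B.
module Submission where

open import Defs
open import Level using (Level; _⊔_; Lift; lift)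
open import Algebra.Bundles using (Group)
open import Data.Product using (Σ; _×_; _,_; proj₁; proj₂)
open import Relation.Binary.PropositionalEquality as ≡ using (_≡_)
import Algebra.Properties.Group as GroupProperties

module _ {c ℓ : Level} (G : Group c ℓ) where
  open Group G
  open GroupProperties G

  ⁻¹-∈-⁻¹· : ∀ {ℓA} {A : Subset G ℓA} {a b g} → A a → a ∙ b ≈ g → _∈_·_ G (b ⁻¹) (g ⁻¹) A
  ⁻¹-∈-⁻¹· {a = a} {b} {g} Aa ab≈g =
    a , Aa , y≈x\\z g (b ⁻¹) a (trans (∙-congʳ (sym ab≈g)) (//-rightDividesʳ b a))

  module Complement {ℓA κ} {A : Subset G ℓA} (kal : IsKaleidoscopical G κ A) where

    Colour : Set κ
    Colour = proj₁ kal

    χ : Carrier → Colour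
    χ = proj₁ (proj₂ kal)

    χ-cong : ∀ {x y} → x ≈ y → χ x ≡ χ y
    χ-cong = proj₁ (proj₂ (proj₂ kal))

    χ-injective-on-· : ∀ g {x y} → _∈_·_ G x g A → _∈_·_ G y g A → χ x ≡ χ y → x ≈ y
    χ-injective-on-· g = proj₁ (proj₂ (proj₂ (proj₂ kal)) g)

    χ-surjective-on-· : ∀ g k → Σ Carrier λ x → _∈_·_ G x g A × (χ x ≡ k)
    χ-surjective-on-· g = proj₂ (proj₂ (proj₂ (proj₂ kal)) g)

    inverseColourClass : Colour → Subset G (c ⊔ ℓ ⊔ ℓA ⊔ κ)
    inverseColourClass k b = Lift (c ⊔ ℓ ⊔ ℓA) (χ (b ⁻¹) ≡ k)

    mul-injective : ∀ k {a a′ b b′} → A a → inverseColourClass k b → A a′ → inverseColourClass k b′ →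
                    a ∙ b ≈ a′ ∙ b′ → (a ≈ a′) × (b ≈ b′)
    mul-injective k {a} {a′} {b} {b′} Aa (lift χb⁻¹≡k) Aa′ (lift χb′⁻¹≡k) ab≈a′b′ =
      ∙-cancelʳ b a a′ (trans ab≈a′b′ (∙-congˡ (sym b≈b′))) , b≈b′
      where
      b≈b′ : b ≈ b′
      b≈b′ = ⁻¹-injective (χ-injective-on-· ((a ∙ b) ⁻¹) (⁻¹-∈-⁻¹· Aa refl) (⁻¹-∈-⁻¹· Aa′ (sym ab≈a′b′))
                                             (≡.trans χb⁻¹≡k (≡.sym χb′⁻¹≡k)))

    mul-surjective : ∀ k x → Σ Carrier λ a → Σ Carrier λ b → A a × inverseColourClass k b × (x ≈ a ∙ b)
    mul-surjective k x with χ-surjective-on-· (x ⁻¹) k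
    ... | y , (a , Aa , y≈x⁻¹a) , χy≡k = a , a \\ x , Aa , lift χ[a⁻¹x]⁻¹≡k , sym (\\-leftDividesˡ a x)
      where
      χ[a⁻¹x]⁻¹≡k : χ ((a \\ x) ⁻¹) ≡ k
      χ[a⁻¹x]⁻¹≡k = ≡.trans (χ-cong (trans (⁻¹-anti-homo-\\ a x) (sym y≈x⁻¹a))) χy≡k

    mulBijective : ∀ k → MulBijective G A (inverseColourClass k)
    mulBijective k = mul-injective k , mul-surjective k

corollary1p3 : ∀ {c ℓ ℓA κ} (G : Group c ℓ) (A : Subset G ℓA) →
    IsKaleidoscopical G κ A → IsComplemented G (c ⊔ ℓ ⊔ ℓA ⊔ κ) A
corollary1p3 G A kal = inverseColourClass (χ ε) , mulBijective (χ ε)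
  where
  open Group G using (ε)
  open Complement G kal
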